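{- Let $c\in\mathbb{N}$, let $\delta>1/c$, and let $\mathrm{ALG}$ be a deterministic algorithm with advice for the Halldórsson–Szegedy guessing game such that on inputs with $n=k^c$ the cost of $\mathrm{ALG}$ is at most $O(n^{1-\delta})$. Then $\mathrm{ALG}$ must read at least $b=\Omega(n\log n)$ bits of advice.
   Context: Halldórsson–Szegedy guessing game (HSGG), a minimization problem: first two integers $k\le n$ with $k$ even are revealed. Then for $i=1,\dots,n$: (1) a set $A_i\subseteq[k]=\{1,\dots,k\}$ with $|A_i|=k/2$ of available characters is revealed; (2) the algorithm answers $y_i\in[n]$ subject to the constraint that for every $t<i$ with $y_t=y_i$, the character $x_t$ belongs to $A_i$; (3) the correct character $x_i\in A_i$ is revealed. The cost of the output $y_1\dots y_n$ is $|\{y_1,\dots,y_n\}|$. A deterministic algorithm with advice additionally reads bits from an advice tape written by an oracle that knows the whole input; each answer depends only on the advice and the information revealed so far. -}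

module Defs where

open import Data.Nat using (ℕ; _<_; _/_)
open import Data.Fin using (Fin; toℕ)
open import Data.Fin.Subset using (Subset; _∈_; ⁅_⁆; ⋃; ∣_∣)
open import Data.List using (List; map; take; allFin)
open import Data.Vec using (Vec)
open import Data.Bool using (Bool)
open import Data.Product using (_×_; _,_)
open import Relation.Binary.PropositionalEquality using (_≡_)

-- Rounds i = 1..n are indexed by Fin n; characters [k] by Fin k.
-- (The constraints k ≤ n and k even are imposed where Instance is used.)
record Instance (n k : ℕ) : Set where
  field
    A      : Fin n → Subset k
    x      : Fin n → Fin k
    A-size : ∀ i → ∣ A i ∣ ≡ k / 2
    x∈A    : ∀ i → x i ∈ A i
open Instance public

-- Everything revealed strictly before step (2) of round i, apart from n, k and
-- A_i itself: the pairs (A_j, x_j) for j < i, in order.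
history : ∀ {n k} → Instance n k → Fin n → List (Subset k × Fin k)
history {n} I i = map (λ j → A I j , x I j) (take (toℕ i) (allFin n))

-- In round i its answer y_i ∈ [n] is a function of n, k,
-- the advice bits, the history (A_j, x_j)_{j<i} and the current set A_i.
Alg : (ℕ → ℕ → ℕ) → Set
Alg b = (n k : ℕ) → Vec Bool (b n k) → List (Subset k × Fin k) → Subset k → Fin n

output : ∀ {b} → Alg b → ∀ {n k} → Vec Bool (b n k) → Instance n k → Fin n → Fin n
output alg {n} {k} φ I i = alg n k φ (history I i) (A I i)

Feasible : ∀ {n k} → (Fin n → Fin n) → Instance n k → Set
Feasible {n} y I = ∀ (t i : Fin n) → toℕ t < toℕ i → y t ≡ y i → x I t ∈ A I i

cost : ∀ {n} → (Fin n → Fin n) → ℕ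
cost {n} y = ∣ ⋃ (map (λ i → ⁅ y i ⁆) (allFin n)) ∣

-- Restrict to k = 2r with the characters split into r complementary pairs: every A_i
-- contains exactly one character of each pair (r free bits), and s further bits
-- (2^s ≤ r) name the pair of the answer x_i, so these inputs carry n(r + s) bits.
-- Given the advice, hence the labels y_i, each round is recoded.  If 2^u distinct
-- answers were already given under the label y_i, feasibility puts them all in A_i, so
-- they fix 2^u bits of A_i, which pays for writing y_i (w bits) and the pair of x_i
-- (s bits).  Otherwise A_i is written out, followed by the u-bit index of x_i among
-- those answers or, if x_i is new for its label, by its s bits; this happens at most
-- 2^u times per label, so at most 2^u · cost times.  Injectivity gives
-- b ≥ n(s − u − 2) − s · 2^u · cost − 1, and with s = 4t, u = t, 16^t ≤ r < 16^(t+1)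
-- and the cost bound this is Ω(n t) = Ω(n log n).

module Submission where

open import Defs
open import Data.Nat using (ℕ; _<_; _≤_; _*_; _^_)
open import Data.Nat.Divisibility using (_∣_)
open import Data.Nat.Logarithm using (⌊log₂_⌋)
open import Data.Vec using (Vec)
open import Data.Bool using (Bool)
open import Data.Product using (_×_; ∃-syntax; Σ-syntax)

open import Data.Nat using (zero; suc; _+_; _∸_; _⊓_; _/_; z≤n; s≤s; z<s; _≤?_; _<?_; NonZero; >-nonZero)
open import Data.Nat.Properties
open import Data.Nat.DivMod using (m*n/n≡m)
open import Data.Nat.Divisibility using (divides)
open import Data.Nat.Logarithm using (⌊log₂⌋-mono-≤; ⌊log₂[2^n]⌋≡n)
open import Data.Nat.Tactic.RingSolver using (solve-∀)
open import Data.Bool using (true; false; not; if_then_else_)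
open import Data.Fin as F using (Fin; zero; suc; toℕ; inject≤; funToFin; finToFun; combine; _↑ˡ_; _↑ʳ_; splitAt; join)
open import Data.Fin.Properties using (2↔Bool; funToFin-finToFin; finToFun-funToFin; inject≤-injective; injective⇒≤; join-splitAt; splitAt-↑ˡ; splitAt-↑ʳ)
open import Data.Fin.Subset using (Subset; ∣_∣; ∁; ⋃; ⁅_⁆) renaming (_∈_ to _∈ₛ_)
open import Data.Fin.Subset.Properties using (∣∁p∣≡n∸∣p∣; ∣p∣≤n; x∈⁅x⁆; x∈p∪q⁺)
open import Data.Vec as V using ([]; _∷_; lookup; tabulate; toList; replicate)
open import Data.Vec.Properties using (tabulate∘lookup; tabulate-cong; lookup∘tabulate; lookup-++ˡ; lookup-++ʳ; lookup-map; []=⇒lookup; lookup⇒[]=)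
import Data.Vec.Properties as Vₚ
open import Data.List as L using (List; []; _∷_; _++_; length; filter; allFin)
open import Data.List.Properties using (∷-injective; ∷-injectiveʳ; length-++; length-map; length-take; map-∘; take-map; map-tabulate; unfold-reverse; ++-identityʳ; ++-assoc)
open import Data.List.Membership.Propositional using (_∈_; _∉_)
open import Data.List.Membership.Propositional.Properties using (∈-lookup; ∈-map⁺; ∈-map⁻; ∈-filter⁺; ∈-filter⁻; ∈-allFin)
open import Data.List.Relation.Unary.Any using (here; there; index; any?)
open import Data.List.Relation.Unary.Any.Properties using (lookup-index)
open import Data.List.Relation.Unary.All as All using (All; []; _∷_)
import Data.List.Relation.Unary.All.Properties as Allₚ
open import Data.List.Relation.Unary.AllPairs using ([]; _∷_)
open import Data.List.Relation.Unary.Unique.Propositional using (Unique)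
import Data.List.Relation.Unary.Unique.Propositional.Properties as Uniqueₚ
open import Data.Product using (_,_; proj₁; proj₂)
import Data.Product as Product
open import Data.Sum using (_⊎_; inj₁; inj₂; [_,_]′)
open import Function using (id; const; _∘_; Injective)
open import Function.Bundles using (Inverse)
open import Relation.Binary.PropositionalEquality using (_≡_; _≢_; refl; sym; trans; cong; cong₂; subst; module ≡-Reasoning)
open import Relation.Nullary using (Dec; yes; no; ¬_; ¬?; contradiction)

open Inverse 2↔Bool using () renaming
  (to to toBool; from to toBit; strictlyInverseˡ to toBool∘toBit; strictlyInverseʳ to toBit∘toBool)

^-cancelˡ-≤ : ∀ m {a c} → 1 < m → m ^ a ≤ m ^ c → a ≤ c
^-cancelˡ-≤ m {a} {c} 1<m m^a≤m^c with a ≤? c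
... | yes a≤c = a≤c
... | no a≰c = contradiction m^a≤m^c (<⇒≱ (^-monoʳ-< m 1<m (≰⇒> a≰c)))

^-cancelʳ-≤ : ∀ q .{{_ : NonZero q}} {m n} → m ^ q ≤ n ^ q → m ≤ n
^-cancelʳ-≤ q {m} {n} m^q≤n^q with m ≤? n
... | yes m≤n = m≤n
... | no m≰n = contradiction m^q≤n^q (<⇒≱ (^-monoˡ-< q (≰⇒> m≰n)))

^-distribʳ-* : ∀ m n q → (m * n) ^ q ≡ m ^ q * n ^ q
^-distribʳ-* m n zero = refl
^-distribʳ-* m n (suc q) = begin
  m * n * (m * n) ^ q          ≡⟨ cong (m * n *_) (^-distribʳ-* m n q) ⟩
  m * n * (m ^ q * n ^ q)      ≡⟨ interchange m n (m ^ q) (n ^ q) ⟩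
  m * m ^ q * (n * n ^ q)      ∎
  where
  open ≡-Reasoning
  interchange : ∀ a b c d → a * b * (c * d) ≡ a * c * (b * d)
  interchange = solve-∀

r+r≡r*2 : ∀ r → r + r ≡ r * 2
r+r≡r*2 r = trans (cong (r +_) (sym (+-identityʳ r))) (*-comm 2 r)

∑ : ∀ {m} → (Fin m → ℕ) → ℕ
∑ {zero} f = 0
∑ {suc m} f = f zero + ∑ (f ∘ suc)

∑-mono-≤ : ∀ {m} {f g : Fin m → ℕ} → (∀ i → f i ≤ g i) → ∑ f ≤ ∑ g
∑-mono-≤ {zero} f≤g = z≤n
∑-mono-≤ {suc m} f≤g = +-mono-≤ (f≤g zero) (∑-mono-≤ (f≤g ∘ suc))

∑-mono-< : ∀ {m} {f g : Fin m → ℕ} → (∀ i → f i ≤ g i) → ∀ j → f j < g j → ∑ f < ∑ g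
∑-mono-< f≤g zero fj<gj = +-mono-<-≤ fj<gj (∑-mono-≤ (f≤g ∘ suc))
∑-mono-< f≤g (suc j) fj<gj = +-mono-≤-< (f≤g zero) (∑-mono-< (f≤g ∘ suc) j fj<gj)

∑-indicator : ∀ {m} c (p : Subset m) → ∑ (λ i → if lookup p i then c else 0) ≡ c * ∣ p ∣
∑-indicator c [] = sym (*-zeroʳ c)
∑-indicator c (true ∷ p) = trans (cong (c +_) (∑-indicator c p)) (sym (*-suc c ∣ p ∣))
∑-indicator c (false ∷ p) = ∑-indicator c p

lookup-ext : ∀ {A : Set} {m} {v w : Vec A m} → (∀ i → lookup v i ≡ lookup w i) → v ≡ w
lookup-ext {v = v} {w} v≗w = trans (sym (tabulate∘lookup v)) (trans (tabulate-cong v≗w) (tabulate∘lookup w))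

funToFin-cong : ∀ {m n} {f g : Fin m → Fin n} → (∀ i → f i ≡ g i) → funToFin f ≡ funToFin g
funToFin-cong {zero} f≗g = refl
funToFin-cong {suc m} f≗g = cong₂ combine (f≗g zero) (funToFin-cong (f≗g ∘ suc))

bitsToFin : ∀ {m} → Vec Bool m → Fin (2 ^ m)
bitsToFin v = funToFin (toBit ∘ lookup v)

finToBits : ∀ {m} → Fin (2 ^ m) → Vec Bool m
finToBits {m} c = tabulate (toBool ∘ finToFun {2} {m} c)

bitsToFin-injective : ∀ {m} → Injective _≡_ _≡_ (bitsToFin {m})
bitsToFin-injective {x = v} {w} eq = lookup-ext λ i → begin
  lookup v i                         ≡⟨ toBool∘toBit _ ⟨
  toBool (toBit (lookup v i))        ≡⟨ cong toBool (finToFun-funToFin _ i) ⟨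
  toBool (finToFun (bitsToFin v) i)  ≡⟨ cong (λ c → toBool (finToFun c i)) eq ⟩
  toBool (finToFun (bitsToFin w) i)  ≡⟨ cong toBool (finToFun-funToFin _ i) ⟩
  toBool (toBit (lookup w i))        ≡⟨ toBool∘toBit _ ⟩
  lookup w i                         ∎
  where open ≡-Reasoning

finToBits-injective : ∀ {m} → Injective _≡_ _≡_ (finToBits {m})
finToBits-injective {m} {c} {d} eq = begin
  c                              ≡⟨ funToFin-finToFin {m} c ⟨
  funToFin (finToFun {2} {m} c)  ≡⟨ funToFin-cong bit≗ ⟩
  funToFin (finToFun {2} {m} d)  ≡⟨ funToFin-finToFin {m} d ⟩
  d                              ∎
  where
  open ≡-Reasoning
  bit≗ : ∀ i → finToFun {2} {m} c i ≡ finToFun {2} {m} d i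
  bit≗ i = begin
    finToFun c i                        ≡⟨ toBit∘toBool _ ⟨
    toBit (toBool (finToFun c i))       ≡⟨ cong toBit (lookup∘tabulate _ i) ⟨
    toBit (lookup (finToBits {m} c) i)  ≡⟨ cong (λ v → toBit (lookup v i)) eq ⟩
    toBit (lookup (finToBits {m} d) i)  ≡⟨ cong toBit (lookup∘tabulate _ i) ⟩
    toBit (toBool (finToFun d i))       ≡⟨ toBit∘toBool _ ⟩
    finToFun d i                        ∎

encodeFin : ∀ {n} w → .(n ≤ 2 ^ w) → Fin n → Vec Bool w
encodeFin w n≤2^w = finToBits ∘ (λ i → inject≤ i n≤2^w)

encodeFin-injective : ∀ {n} w .(n≤2^w : n ≤ 2 ^ w) → Injective _≡_ _≡_ (encodeFin w n≤2^w)
encodeFin-injective w n≤2^w = inject≤-injective n≤2^w n≤2^w _ _ ∘ finToBits-injective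

decodeFin : ∀ {r} s → 2 ^ s ≤ r → Vec Bool s → Fin r
decodeFin s 2^s≤r v = inject≤ (bitsToFin v) 2^s≤r

decodeFin-injective : ∀ {r} s (2^s≤r : 2 ^ s ≤ r) → Injective _≡_ _≡_ (decodeFin s 2^s≤r)
decodeFin-injective s 2^s≤r = bitsToFin-injective ∘ inject≤-injective 2^s≤r 2^s≤r _ _

bits-injection⇒≤ : ∀ {m n} (f : Vec Bool m → Vec Bool n) → Injective _≡_ _≡_ f → m ≤ n
bits-injection⇒≤ f f-inj = ^-cancelˡ-≤ 2 (s≤s (s≤s z≤n)) (injective⇒≤ {f = bitsToFin ∘ f ∘ finToBits}
  (finToBits-injective ∘ f-inj ∘ bitsToFin-injective))

toList-++-injective : ∀ {A : Set} {m} (v w : Vec A m) {xs ys : List A} →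
  toList v ++ xs ≡ toList w ++ ys → v ≡ w × xs ≡ ys
toList-++-injective [] [] eq = refl , eq
toList-++-injective (a ∷ v) (b ∷ w) eq with ∷-injective eq
... | refl , eq′ = Product.map₁ (cong (a ∷_)) (toList-++-injective v w eq′)

length-toList-++ : ∀ {A : Set} {m} (v : Vec A m) (xs : List A) → length (toList v ++ xs) ≡ m + length xs
length-toList-++ [] xs = refl
length-toList-++ (a ∷ v) xs = cong suc (length-toList-++ v xs)

map-++-injective : ∀ {A B : Set} (f g : A → B) (qs : List A) {xs ys : List B} →
  L.map f qs ++ xs ≡ L.map g qs ++ ys → (∀ {q} → q ∈ qs → f q ≡ g q) × xs ≡ ys
map-++-injective f g [] eq = (λ ()) , eq
map-++-injective f g (q ∷ qs) eq with ∷-injective eq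
... | fq≡gq , eq′ with map-++-injective f g qs eq′
... | f≗g , xs≡ys = (λ { (here refl) → fq≡gq ; (there q∈qs) → f≗g q∈qs }) , xs≡ys

Unique⇒length≤ : ∀ {m} (xs : List (Fin m)) → Unique xs → length xs ≤ m
Unique⇒length≤ xs xs! = injective⇒≤ (lookup-injective xs xs!)
  where
  lookup-injective : ∀ xs → Unique xs → Injective _≡_ _≡_ (L.lookup xs)
  lookup-injective (x ∷ xs) (x∉ ∷ xs!) {F.zero} {F.zero} _ = refl
  lookup-injective (x ∷ xs) (x∉ ∷ xs!) {F.zero} {F.suc j} eq = contradiction eq (All.lookup x∉ (∈-lookup j))
  lookup-injective (x ∷ xs) (x∉ ∷ xs!) {F.suc i} {F.zero} eq = contradiction (sym eq) (All.lookup x∉ (∈-lookup i))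
  lookup-injective (x ∷ xs) (x∉ ∷ xs!) {F.suc i} {F.suc j} eq = cong F.suc (lookup-injective xs xs! eq)

pad : ∀ ℓ → List Bool → Vec Bool (suc ℓ)
pad ℓ [] = true ∷ replicate ℓ false
pad zero (b ∷ bs) = true ∷ []
pad (suc ℓ) (b ∷ bs) = b ∷ pad ℓ bs

pad≢zeros : ∀ ℓ bs → length bs ≤ ℓ → pad ℓ bs ≢ false ∷ replicate ℓ false
pad≢zeros ℓ [] _ ()
pad≢zeros (suc ℓ) (b ∷ bs) (s≤s ∣bs∣≤ℓ) eq = pad≢zeros ℓ bs ∣bs∣≤ℓ (Vₚ.∷-injectiveʳ eq)

pad-injective : ∀ ℓ bs cs → length bs ≤ ℓ → length cs ≤ ℓ → pad ℓ bs ≡ pad ℓ cs → bs ≡ cs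
pad-injective ℓ [] [] _ _ _ = refl
pad-injective (suc ℓ) [] (c ∷ cs) _ (s≤s ∣cs∣≤ℓ) eq = contradiction (sym (Vₚ.∷-injectiveʳ eq)) (pad≢zeros ℓ cs ∣cs∣≤ℓ)
pad-injective (suc ℓ) (b ∷ bs) [] (s≤s ∣bs∣≤ℓ) _ eq = contradiction (Vₚ.∷-injectiveʳ eq) (pad≢zeros ℓ bs ∣bs∣≤ℓ)
pad-injective (suc ℓ) (b ∷ bs) (c ∷ cs) (s≤s ∣bs∣≤ℓ) (s≤s ∣cs∣≤ℓ) eq with Vₚ.∷-injective eq
... | refl , eq′ = cong (b ∷_) (pad-injective ℓ bs cs ∣bs∣≤ℓ ∣cs∣≤ℓ eq′)

module _ {A : Set} (n r s : ℕ) where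

  private
    split : Vec A (r + s) → Vec A r × Vec A s
    split row = V.take r row , V.drop r row

    unsplit : Vec A r × Vec A s → Vec A (r + s)
    unsplit (v , w) = v V.++ w

  rows : Vec A (n * (r + s)) → Vec (Vec A r × Vec A s) n
  rows xs = V.map split (proj₁ (V.group n (r + s) xs))

  rows-injective : Injective _≡_ _≡_ rows
  rows-injective {xs} {ys} eq = trans (unrows∘rows xs) (trans (cong unrows eq) (sym (unrows∘rows ys)))
    where
    unrows : Vec (Vec A r × Vec A s) n → Vec A (n * (r + s))
    unrows = V.concat ∘ V.map unsplit

    unrows∘rows : ∀ xs → xs ≡ unrows (rows xs)
    unrows∘rows xs with V.group n (r + s) xs
    ... | xss , refl = cong V.concat (begin
      xss                             ≡⟨ Vₚ.map-id xss ⟨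
      V.map id xss                    ≡⟨ Vₚ.map-cong (λ row → proj₂ (proj₂ (V.splitAt r row))) xss ⟩
      V.map (unsplit ∘ split) xss     ≡⟨ Vₚ.map-∘ unsplit split xss ⟩
      V.map unsplit (V.map split xss) ∎)
      where open ≡-Reasoning

_∈?_ : ∀ {m} (x : Fin m) (xs : List (Fin m)) → Dec (x ∈ xs)
x ∈? xs = any? (x F.≟_) xs

addNew : ∀ {A : Set} (x : A) (xs : List A) → Dec (x ∈ xs) → List A
addNew x xs (yes _) = xs
addNew x xs (no _) = x ∷ xs

module _ {A : Set} {x : A} {xs : List A} where

  addNew-unique : ∀ x? → Unique xs → Unique (addNew x xs x?)
  addNew-unique (yes _) xs! = xs!
  addNew-unique (no x∉) xs! = All.tabulate (λ y∈ x≡y → x∉ (subst (_∈ xs) (sym x≡y) y∈)) ∷ xs!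

  length-addNew : ∀ x? → length xs ≤ length (addNew x xs x?)
  length-addNew (yes _) = ≤-refl
  length-addNew (no _) = n≤1+n _

  addNew-∉ : x ∉ xs → ∀ x? → addNew x xs x? ≡ x ∷ xs
  addNew-∉ x∉ (yes x∈) = contradiction x∈ x∉
  addNew-∉ x∉ (no _) = refl

  ∈-addNew⁻ : ∀ {z} x? → z ∈ addNew x xs x? → z ∈ xs ⊎ z ≡ x
  ∈-addNew⁻ (yes _) z∈ = inj₁ z∈
  ∈-addNew⁻ (no _) (here z≡x) = inj₂ z≡x
  ∈-addNew⁻ (no _) (there z∈) = inj₁ z∈

Unique-map⁺ : ∀ {A B : Set} {f : A → B} {P : A → Set} {xs : List A} →
  (∀ {x y} → P x → P y → f x ≡ f y → x ≡ y) → All P xs → Unique xs → Unique (L.map f xs)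
Unique-map⁺ f-inj [] [] = []
Unique-map⁺ {f = f} {xs = x ∷ xs} f-inj (px ∷ pxs) (x∉ ∷ xs!) = All.tabulate fx∉ ∷ Unique-map⁺ f-inj pxs xs!
  where
  fx∉ : ∀ {fy} → fy ∈ L.map f xs → f x ≢ fy
  fx∉ fy∈ fx≡fy with ∈-map⁻ f fy∈
  ... | y , y∈ , refl = All.lookup x∉ y∈ (f-inj px (All.lookup pxs y∈) fx≡fy)

-- The hard inputs

∣++∣ : ∀ {m n} (p : Subset m) (q : Subset n) → ∣ p V.++ q ∣ ≡ ∣ p ∣ + ∣ q ∣
∣++∣ [] q = refl
∣++∣ (true ∷ p) q = cong suc (∣++∣ p q)
∣++∣ (false ∷ p) q = ∣++∣ p q

module PairedAlphabet (r : ℕ) where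

  char : Fin r → Bool → Fin (r + r)
  char p true = p ↑ˡ r
  char p false = r ↑ʳ p

  pairOf : Fin (r + r) → Fin r
  pairOf z = [ id , id ]′ (splitAt r z)

  bitOf : Fin (r + r) → Bool
  bitOf z = [ const true , const false ]′ (splitAt r z)

  char-pairOf-bitOf : ∀ z → char (pairOf z) (bitOf z) ≡ z
  char-pairOf-bitOf z with splitAt r z in eq
  ... | inj₁ p = trans (cong (join r r) (sym eq)) (join-splitAt r r z)
  ... | inj₂ p = trans (cong (join r r) (sym eq)) (join-splitAt r r z)

  pairOf-char : ∀ p β → pairOf (char p β) ≡ p
  pairOf-char p true rewrite splitAt-↑ˡ r p r = refl
  pairOf-char p false rewrite splitAt-↑ʳ r r p = refl

  halfSet : Vec Bool r → Subset (r + r)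
  halfSet v = v V.++ ∁ v

  ∣halfSet∣ : ∀ v → ∣ halfSet v ∣ ≡ (r + r) / 2
  ∣halfSet∣ v = begin
    ∣ v V.++ ∁ v ∣       ≡⟨ ∣++∣ v (∁ v) ⟩
    ∣ v ∣ + ∣ ∁ v ∣      ≡⟨ cong (∣ v ∣ +_) (∣∁p∣≡n∸∣p∣ v) ⟩
    ∣ v ∣ + (r ∸ ∣ v ∣)  ≡⟨ m+[n∸m]≡n (∣p∣≤n v) ⟩
    r                    ≡⟨ m*n/n≡m r 2 ⟨
    r * 2 / 2            ≡⟨ cong (_/ 2) (r+r≡r*2 r) ⟨
    (r + r) / 2          ∎
    where open ≡-Reasoning

  lookup-halfSet-true : ∀ v p → lookup (halfSet v) (char p true) ≡ lookup v p
  lookup-halfSet-true v p = lookup-++ˡ v (∁ v) p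

  lookup-halfSet-false : ∀ v p → lookup (halfSet v) (char p false) ≡ not (lookup v p)
  lookup-halfSet-false v p = trans (lookup-++ʳ v (∁ v) p) (lookup-map p not v)

  char∈halfSet : ∀ v p → char p (lookup v p) ∈ₛ halfSet v
  char∈halfSet v p with lookup v p in eq
  ... | true = lookup⇒[]= _ (halfSet v) (trans (lookup-halfSet-true v p) eq)
  ... | false = lookup⇒[]= _ (halfSet v) (trans (lookup-halfSet-false v p) (cong not eq))

  char∈halfSet⇒ : ∀ v p β → char p β ∈ₛ halfSet v → lookup v p ≡ β
  char∈halfSet⇒ v p true z∈A = trans (sym (lookup-halfSet-true v p)) ([]=⇒lookup z∈A)
  char∈halfSet⇒ v p false z∈A with lookup v p in eq
  ... | false = refl
  ... | true with () ← trans (sym (trans (lookup-halfSet-false v p) (cong not eq))) ([]=⇒lookup z∈A)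

  ∈halfSet⇒ : ∀ v {z} → z ∈ₛ halfSet v → lookup v (pairOf z) ≡ bitOf z
  ∈halfSet⇒ v {z} z∈A = char∈halfSet⇒ v (pairOf z) (bitOf z) (subst (_∈ₛ halfSet v) (sym (char-pairOf-bitOf z)) z∈A)

  pairOf-injectiveOn-halfSet : ∀ v {z z′} → z ∈ₛ halfSet v → z′ ∈ₛ halfSet v → pairOf z ≡ pairOf z′ → z ≡ z′
  pairOf-injectiveOn-halfSet v {z} {z′} z∈A z′∈A same-pair = begin
    z                            ≡⟨ char-pairOf-bitOf z ⟨
    char (pairOf z) (bitOf z)    ≡⟨ cong₂ char same-pair same-bit ⟩
    char (pairOf z′) (bitOf z′)  ≡⟨ char-pairOf-bitOf z′ ⟩
    z′                           ∎
    where
    open ≡-Reasoning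
    same-bit : bitOf z ≡ bitOf z′
    same-bit = trans (sym (∈halfSet⇒ v z∈A)) (trans (cong (lookup v) same-pair) (∈halfSet⇒ v z′∈A))

module Rounds (r s : ℕ) (2^s≤r : 2 ^ s ≤ r) where
  open PairedAlphabet r public

  Round : Set
  Round = Vec Bool r × Vec Bool s

  available : Round → Subset (r + r)
  available (v , _) = halfSet v

  position : Round → Fin r
  position (_ , j) = decodeFin s 2^s≤r j

  answer : Round → Fin (r + r)
  answer ρ@(v , _) = char (position ρ) (lookup v (position ρ))

  answer∈available : ∀ ρ → answer ρ ∈ₛ available ρ
  answer∈available ρ@(v , _) = char∈halfSet v (position ρ)

  position≡pairOf-answer : ∀ ρ → position ρ ≡ pairOf (answer ρ)
  position≡pairOf-answer ρ@(v , _) = sym (pairOf-char (position ρ) (lookup v (position ρ)))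

  answer-injective : ∀ {v j j′} → answer (v , j) ≡ answer (v , j′) → j ≡ j′
  answer-injective {v} {j} {j′} eq = decodeFin-injective s 2^s≤r (begin
    position (v , j)          ≡⟨ position≡pairOf-answer (v , j) ⟩
    pairOf (answer (v , j))   ≡⟨ cong pairOf eq ⟩
    pairOf (answer (v , j′))  ≡⟨ position≡pairOf-answer (v , j′) ⟨
    position (v , j′)         ∎)
    where open ≡-Reasoning

  -- Traces list the rounds played so far, the most recent one first.
  historyOf : List Round → List (Subset (r + r) × Fin (r + r))
  historyOf σ = L.map (λ ρ → available ρ , answer ρ) (L.reverse σ)

  before : List Round → ∀ {m} → Vec Round m → Fin m → List Round
  before σ (ρ ∷ ρs) zero = σ
  before σ (ρ ∷ ρs) (suc i) = before (ρ ∷ σ) ρs i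

  after : List Round → ∀ {m} → Vec Round m → List Round
  after σ [] = σ
  after σ (ρ ∷ ρs) = after (ρ ∷ σ) ρs

-- Recoding the rounds with the help of the answers

module RoundCode (r s w u n : ℕ) (2^s≤r : 2 ^ s ≤ r) (n≤2^w : n ≤ 2 ^ w)
                 (label : List (Subset (r + r) × Fin (r + r)) → Subset (r + r) → Fin n) where
  open Rounds r s 2^s≤r

  labelOf : List Round → Round → Fin n
  labelOf σ ρ = label (historyOf σ) (available ρ)

  seen : List Round → Fin n → List (Fin (r + r))
  seen [] g = []
  seen (ρ ∷ σ) g with labelOf σ ρ F.≟ g
  ... | yes _ = addNew (answer ρ) (seen σ g) (answer ρ ∈? seen σ g)
  ... | no _ = seen σ g

  seen-unique : ∀ σ g → Unique (seen σ g)
  seen-unique [] g = []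
  seen-unique (ρ ∷ σ) g with labelOf σ ρ F.≟ g
  ... | yes _ = addNew-unique _ (seen-unique σ g)
  ... | no _ = seen-unique σ g

  length-seen-mono : ∀ σ ρ g → length (seen σ g) ≤ length (seen (ρ ∷ σ) g)
  length-seen-mono σ ρ g with labelOf σ ρ F.≟ g
  ... | yes _ = length-addNew {x = answer ρ} {seen σ g} (answer ρ ∈? seen σ g)
  ... | no _ = ≤-refl

  ∈-seen-∷ : ∀ σ ρ {g z} → z ∈ seen (ρ ∷ σ) g → z ∈ seen σ g ⊎ (labelOf σ ρ ≡ g × z ≡ answer ρ)
  ∈-seen-∷ σ ρ {g} z∈ with labelOf σ ρ F.≟ g
  ... | no _ = inj₁ z∈
  ... | yes same with ∈-addNew⁻ (answer ρ ∈? seen σ g) z∈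
  ...   | inj₁ z∈′ = inj₁ z∈′
  ...   | inj₂ z≡ = inj₂ (same , z≡)

  priorAnswers : List Round → Round → List (Fin (r + r))
  priorAnswers σ ρ = seen σ (labelOf σ ρ)

  seen-fresh : ∀ {σ ρ} → answer ρ ∉ priorAnswers σ ρ → seen (ρ ∷ σ) (labelOf σ ρ) ≡ answer ρ ∷ priorAnswers σ ρ
  seen-fresh {σ} {ρ} new with labelOf σ ρ F.≟ labelOf σ ρ
  ... | yes _ = addNew-∉ new _
  ... | no ≢ = contradiction refl ≢

  Consistent : List Round → Round → Set
  Consistent σ ρ = All (_∈ₛ available ρ) (priorAnswers σ ρ)

  data Kind (σ : List Round) (ρ : Round) : Set where
    saturated : 2 ^ u ≤ length (priorAnswers σ ρ) → Kind σ ρ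
    repeated  : length (priorAnswers σ ρ) < 2 ^ u → answer ρ ∈ priorAnswers σ ρ → Kind σ ρ
    fresh     : length (priorAnswers σ ρ) < 2 ^ u → answer ρ ∉ priorAnswers σ ρ → Kind σ ρ

  kind : ∀ σ ρ → Kind σ ρ
  kind σ ρ with 2 ^ u ≤? length (priorAnswers σ ρ) | answer ρ ∈? priorAnswers σ ρ
  ... | yes sat | _ = saturated sat
  ... | no unsat | yes old = repeated (≰⇒> unsat) old
  ... | no unsat | no new = fresh (≰⇒> unsat) new

  charge : ∀ {σ ρ} → Kind σ ρ → ℕ
  charge (fresh _ _) = 1
  charge _ = 0

  freePairs : List (Fin r) → List (Fin r)
  freePairs P = filter (λ p → ¬? (p ∈? P)) (allFin r)

  freeBits : List (Fin (r + r)) → Vec Bool r → List Bool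
  freeBits J v = L.map (lookup v) (freePairs (L.map pairOf J))

  -- Saturated rounds send the label and only the bits of A_i that its 2^u earlier
  -- answers do not already fix; the others send A_i and then either the index of
  -- the repeated answer or the position of the fresh one.
  encode : ∀ {σ ρ} → Kind σ ρ → List Bool → List Bool
  encode {σ} {ρ@(v , j)} (saturated _) bs =
    true ∷ toList (encodeFin w n≤2^w (labelOf σ ρ)) ++ freeBits (L.take (2 ^ u) (priorAnswers σ ρ)) v ++ toList j ++ bs
  encode {σ} {v , j} (repeated unsat old) bs = false ∷ true ∷ toList v ++ toList (encodeFin u (<⇒≤ unsat) (index old)) ++ bs
  encode {σ} {v , j} (fresh _ _) bs = false ∷ false ∷ toList v ++ toList j ++ bs

  halfSets-agree : ∀ {v v′ : Vec Bool r} {J} → All (_∈ₛ halfSet v) J → All (_∈ₛ halfSet v′) J →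
    ∀ {p} → p ∈ L.map pairOf J → lookup v p ≡ lookup v′ p
  halfSets-agree {v} {v′} J⊆A J⊆A′ p∈ with ∈-map⁻ pairOf p∈
  ... | z , z∈J , refl = trans (∈halfSet⇒ v (All.lookup J⊆A z∈J)) (sym (∈halfSet⇒ v′ (All.lookup J⊆A′ z∈J)))

  freeBits-injective : ∀ J {v v′ bs bs′} → All (_∈ₛ halfSet v) J → All (_∈ₛ halfSet v′) J →
    freeBits J v ++ bs ≡ freeBits J v′ ++ bs′ → v ≡ v′ × bs ≡ bs′
  freeBits-injective J {v} {v′} J⊆A J⊆A′ eq with map-++-injective (lookup v) (lookup v′) (freePairs (L.map pairOf J)) eq
  ... | agree-free , bs≡ = lookup-ext agree , bs≡
    where
    agree : ∀ p → lookup v p ≡ lookup v′ p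
    agree p with p ∈? L.map pairOf J
    ... | yes fixed = halfSets-agree {v} {v′} J⊆A J⊆A′ fixed
    ... | no free = agree-free (∈-filter⁺ (λ p → ¬? (p ∈? L.map pairOf J)) (∈-allFin p) free)

  saturated-injective : ∀ σ {g g′} {v v′ : Vec Bool r} {j j′ : Vec Bool s} {bs bs′} → All (_∈ₛ halfSet v) (seen σ g) → All (_∈ₛ halfSet v′) (seen σ g′) →
    toList (encodeFin w n≤2^w g) ++ freeBits (L.take (2 ^ u) (seen σ g)) v ++ toList j ++ bs ≡
    toList (encodeFin w n≤2^w g′) ++ freeBits (L.take (2 ^ u) (seen σ g′)) v′ ++ toList j′ ++ bs′ →
    v ≡ v′ × j ≡ j′ × bs ≡ bs′
  saturated-injective σ {g} {g′} {v} {v′} {j} {j′} J⊆A J⊆A′ eq with toList-++-injective (encodeFin w n≤2^w g) (encodeFin w n≤2^w g′) eq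
  ... | label≡ , eq′ with encodeFin-injective w n≤2^w label≡
  ... | refl with freeBits-injective (L.take (2 ^ u) (seen σ g)) {v} {v′} (Allₚ.take⁺ (2 ^ u) J⊆A) (Allₚ.take⁺ (2 ^ u) J⊆A′) eq′
  ... | refl , eq″ with toList-++-injective j j′ eq″
  ... | refl , bs≡ = refl , refl , bs≡

  encode-injective : ∀ {σ ρ ρ′} (κ : Kind σ ρ) (κ′ : Kind σ ρ′) {bs bs′} → Consistent σ ρ → Consistent σ ρ′ →
    encode κ bs ≡ encode κ′ bs′ → ρ ≡ ρ′ × bs ≡ bs′
  encode-injective {σ} {v , j} {v′ , j′} (saturated _) (saturated _) {bs} {bs′} c c′ eq
    with saturated-injective σ {labelOf σ (v , j)} {labelOf σ (v′ , j′)} {v} {v′} {j} {j′} {bs} {bs′} c c′ (∷-injectiveʳ eq)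
  ... | refl , refl , bs≡ = refl , bs≡
  encode-injective {σ} {v , j} {v′ , j′} (repeated _ old) (repeated _ old′) _ _ eq
    with toList-++-injective v v′ (∷-injectiveʳ (∷-injectiveʳ eq))
  ... | refl , eq′ with toList-++-injective (encodeFin u _ (index old)) (encodeFin u _ (index old′)) eq′
  ... | index≡ , bs≡ = cong (v ,_) (answer-injective {v} same-answer) , bs≡
    where
    same-answer : answer (v , j) ≡ answer (v , j′)
    same-answer = trans (lookup-index old) (trans (cong (L.lookup (priorAnswers σ (v , j))) (encodeFin-injective u _ index≡)) (sym (lookup-index old′)))
  encode-injective {ρ = v , j} {v′ , j′} (fresh _ _) (fresh _ _) _ _ eq
    with toList-++-injective v v′ (∷-injectiveʳ (∷-injectiveʳ eq))
  ... | refl , eq′ with toList-++-injective j j′ eq′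
  ... | refl , bs≡ = refl , bs≡
  encode-injective (saturated _) (repeated _ _) _ _ ()
  encode-injective (saturated _) (fresh _ _) _ _ ()
  encode-injective (repeated _ _) (saturated _) _ _ ()
  encode-injective (repeated _ _) (fresh _ _) _ _ ()
  encode-injective (fresh _ _) (saturated _) _ _ ()
  encode-injective (fresh _ _) (repeated _ _) _ _ ()

  potential : List Round → ℕ
  potential σ = ∑ λ g → length (seen σ g) ⊓ 2 ^ u

  potential-step : ∀ {σ ρ} (κ : Kind σ ρ) → charge κ + potential σ ≤ potential (ρ ∷ σ)
  potential-step {σ} {ρ} (saturated _) = ∑-mono-≤ (λ g → ⊓-monoˡ-≤ (2 ^ u) (length-seen-mono σ ρ g))
  potential-step {σ} {ρ} (repeated _ _) = ∑-mono-≤ (λ g → ⊓-monoˡ-≤ (2 ^ u) (length-seen-mono σ ρ g))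
  potential-step {σ} {ρ} (fresh unsat new) =
    ∑-mono-< (λ g → ⊓-monoˡ-≤ (2 ^ u) (length-seen-mono σ ρ g)) (labelOf σ ρ) grows
    where
    grows : length (priorAnswers σ ρ) ⊓ 2 ^ u < length (seen (ρ ∷ σ) (labelOf σ ρ)) ⊓ 2 ^ u
    grows rewrite seen-fresh {σ} {ρ} new | m≤n⇒m⊓n≡m (<⇒≤ unsat) | m≤n⇒m⊓n≡m unsat = ≤-refl

  encodeRun : List Round → ∀ {m} → Vec Round m → List Bool
  encodeRun σ [] = []
  encodeRun σ (ρ ∷ ρs) = encode (kind σ ρ) (encodeRun (ρ ∷ σ) ρs)

  ConsistentRun : List Round → ∀ {m} → Vec Round m → Set
  ConsistentRun σ ρs = ∀ i → Consistent (before σ ρs i) (lookup ρs i)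

  totalCharge : List Round → ∀ {m} → Vec Round m → ℕ
  totalCharge σ [] = 0
  totalCharge σ (ρ ∷ ρs) = charge (kind σ ρ) + totalCharge (ρ ∷ σ) ρs

  labelAt : List Round → ∀ {m} → Vec Round m → Fin m → Fin n
  labelAt σ ρs t = labelOf (before σ ρs t) (lookup ρs t)

  encodeRun-injective : ∀ σ {m} {ρs ρs′ : Vec Round m} → ConsistentRun σ ρs → ConsistentRun σ ρs′ →
    encodeRun σ ρs ≡ encodeRun σ ρs′ → ρs ≡ ρs′
  encodeRun-injective σ {ρs = []} {[]} _ _ _ = refl
  encodeRun-injective σ {ρs = ρ ∷ ρs} {ρ′ ∷ ρs′} c c′ eq with encode-injective (kind σ ρ) (kind σ ρ′) (c zero) (c′ zero) eq
  ... | refl , eq′ = cong (ρ ∷_) (encodeRun-injective (ρ ∷ σ) (c ∘ suc) (c′ ∘ suc) eq′)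

  totalCharge≤potential : ∀ σ {m} (ρs : Vec Round m) → totalCharge σ ρs + potential σ ≤ potential (after σ ρs)
  totalCharge≤potential σ [] = ≤-refl
  totalCharge≤potential σ (ρ ∷ ρs) = begin
    charge κ + T + potential σ    ≡⟨ regroup (charge κ) T (potential σ) ⟩
    T + (charge κ + potential σ)  ≤⟨ +-monoʳ-≤ T (potential-step κ) ⟩
    T + potential (ρ ∷ σ)         ≤⟨ totalCharge≤potential (ρ ∷ σ) ρs ⟩
    potential (after σ (ρ ∷ ρs))  ∎
    where
    open ≤-Reasoning
    κ : Kind σ ρ
    κ = kind σ ρ
    T : ℕ
    T = totalCharge (ρ ∷ σ) ρs
    regroup : ∀ a b c → a + b + c ≡ b + (a + c)
    regroup = solve-∀

  ∈-seen-before : ∀ σ {m} (ρs : Vec Round m) i {g z} → z ∈ seen (before σ ρs i) g →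
    z ∈ seen σ g ⊎ ∃[ t ] toℕ t < toℕ i × labelAt σ ρs t ≡ g × z ≡ answer (lookup ρs t)
  ∈-seen-before σ (ρ ∷ ρs) zero z∈ = inj₁ z∈
  ∈-seen-before σ (ρ ∷ ρs) (suc i) z∈ with ∈-seen-before (ρ ∷ σ) ρs i z∈
  ... | inj₂ (t , t<i , same , z≡) = inj₂ (suc t , s≤s t<i , same , z≡)
  ... | inj₁ z∈′ with ∈-seen-∷ σ ρ z∈′
  ...   | inj₁ z∈″ = inj₁ z∈″
  ...   | inj₂ (same , z≡) = inj₂ (zero , s≤s z≤n , same , z≡)

  ∈-seen-after : ∀ σ {m} (ρs : Vec Round m) {g z} → z ∈ seen (after σ ρs) g →
    z ∈ seen σ g ⊎ ∃[ t ] labelAt σ ρs t ≡ g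
  ∈-seen-after σ [] z∈ = inj₁ z∈
  ∈-seen-after σ (ρ ∷ ρs) z∈ with ∈-seen-after (ρ ∷ σ) ρs z∈
  ... | inj₂ (t , same) = inj₂ (suc t , same)
  ... | inj₁ z∈′ with ∈-seen-∷ σ ρ z∈′
  ...   | inj₁ z∈″ = inj₁ z∈″
  ...   | inj₂ (same , _) = inj₂ (zero , same)

  length-freeBits : ∀ J {v} → Unique (L.map pairOf J) → length (freeBits J v) + length J ≤ r
  length-freeBits J {v} P! = begin
    length (freeBits J v) + length J                 ≡⟨ cong₂ _+_ (length-map (lookup v) free) (sym (length-map pairOf J)) ⟩
    length free + length P                           ≡⟨ length-++ free ⟨
    length (free ++ P)                               ≤⟨ Unique⇒length≤ (free ++ P) (Uniqueₚ.++⁺ free! P! free#P) ⟩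
    r                                                ∎
    where
    open ≤-Reasoning
    P free : List (Fin r)
    P = L.map pairOf J
    free = freePairs P
    free! : Unique free
    free! = Uniqueₚ.filter⁺ (λ p → ¬? (p ∈? P)) (Uniqueₚ.allFin⁺ r)
    free#P : ∀ {p} → ¬ (p ∈ free × p ∈ P)
    free#P (p∈free , p∈P) = proj₂ (∈-filter⁻ (λ p → ¬? (p ∈? P)) {xs = allFin r} p∈free) p∈P

  module _ (w+s≤2^u : w + s ≤ 2 ^ u) where

    length-encode : ∀ {σ ρ} (κ : Kind σ ρ) bs → Consistent σ ρ →
      length (encode κ bs) ≤ 2 + r + u + s * charge κ + length bs
    length-encode {σ} {ρ@(v , j)} (saturated sat) bs c = begin
      suc (length (toList E ++ F ++ toList j ++ bs))  ≡⟨ cong suc (length-toList-++ E _) ⟩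
      suc (w + length (F ++ toList j ++ bs))          ≡⟨ cong (λ ℓ → suc (w + ℓ)) (length-++ F) ⟩
      suc (w + (length F + length (toList j ++ bs)))  ≡⟨ cong (λ ℓ → suc (w + (length F + ℓ))) (length-toList-++ j bs) ⟩
      suc (w + (length F + (s + length bs)))          ≡⟨ cong suc (regroup w (length F) s (length bs)) ⟩
      suc (length F + (w + s) + length bs)            ≤⟨ s≤s (+-monoˡ-≤ (length bs) (+-monoʳ-≤ (length F) w+s≤∣J∣)) ⟩
      suc (length F + length J + length bs)           ≤⟨ s≤s (+-monoˡ-≤ (length bs) (length-freeBits J {v} P!)) ⟩
      suc (r + length bs)                             ≤⟨ s≤s (+-monoˡ-≤ (length bs) (m≤m+n r u)) ⟩
      suc (r + u + length bs)                         ≤⟨ n≤1+n _ ⟩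
      2 + r + u + length bs                           ≡⟨ no-charge r u s (length bs) ⟩
      2 + r + u + s * 0 + length bs                   ∎
      where
      open ≤-Reasoning
      E : Vec Bool w
      E = encodeFin w n≤2^w (labelOf σ ρ)
      J : List (Fin (r + r))
      J = L.take (2 ^ u) (priorAnswers σ ρ)
      F : List Bool
      F = freeBits J v
      regroup : ∀ w f s b → w + (f + (s + b)) ≡ f + (w + s) + b
      regroup = solve-∀
      no-charge : ∀ r u s b → 2 + r + u + b ≡ 2 + r + u + s * 0 + b
      no-charge = solve-∀
      w+s≤∣J∣ : w + s ≤ length J
      w+s≤∣J∣ = ≤-trans w+s≤2^u (≤-reflexive (sym (trans (length-take (2 ^ u) (priorAnswers σ ρ)) (m≤n⇒m⊓n≡m sat))))
      P! : Unique (L.map pairOf J)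
      P! = Unique-map⁺ (pairOf-injectiveOn-halfSet v) (Allₚ.take⁺ (2 ^ u) c) (Uniqueₚ.take⁺ (2 ^ u) (seen-unique σ (labelOf σ ρ)))
    length-encode {ρ = v , j} (repeated unsat old) bs _ = s≤s (s≤s (≤-reflexive (begin
      length (toList v ++ toList I ++ bs)  ≡⟨ length-toList-++ v _ ⟩
      r + length (toList I ++ bs)          ≡⟨ cong (r +_) (length-toList-++ I bs) ⟩
      r + (u + length bs)                  ≡⟨ regroup r u s (length bs) ⟩
      r + u + s * 0 + length bs            ∎)))
      where
      open ≡-Reasoning
      regroup : ∀ r u s b → r + (u + b) ≡ r + u + s * 0 + b
      regroup = solve-∀
      I : Vec Bool u
      I = encodeFin u (<⇒≤ unsat) (index old)
    length-encode {ρ = v , j} (fresh _ _) bs _ = s≤s (s≤s (begin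
      length (toList v ++ toList j ++ bs)  ≡⟨ length-toList-++ v _ ⟩
      r + length (toList j ++ bs)          ≡⟨ cong (r +_) (length-toList-++ j bs) ⟩
      r + (s + length bs)                  ≤⟨ +-monoʳ-≤ r (m≤n+m (s + length bs) u) ⟩
      r + (u + (s + length bs))            ≡⟨ regroup r u s (length bs) ⟩
      r + u + s * 1 + length bs            ∎))
      where
      open ≤-Reasoning
      regroup : ∀ r u s b → r + (u + (s + b)) ≡ r + u + s * 1 + b
      regroup = solve-∀

    length-encodeRun : ∀ σ {m} (ρs : Vec Round m) → ConsistentRun σ ρs →
      length (encodeRun σ ρs) ≤ m * (2 + r + u) + s * totalCharge σ ρs
    length-encodeRun σ [] _ = z≤n
    length-encodeRun σ {suc m} (ρ ∷ ρs) c = begin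
      length (encode κ rest)               ≤⟨ length-encode κ rest (c zero) ⟩
      B + s * charge κ + length rest       ≤⟨ +-monoʳ-≤ (B + s * charge κ) (length-encodeRun (ρ ∷ σ) ρs (c ∘ suc)) ⟩
      B + s * charge κ + (m * B + s * T)   ≡⟨ regroup B s (charge κ) m T ⟩
      suc m * B + s * (charge κ + T)       ∎
      where
      open ≤-Reasoning
      κ : Kind σ ρ
      κ = kind σ ρ
      rest : List Bool
      rest = encodeRun (ρ ∷ σ) ρs
      B T : ℕ
      B = 2 + r + u
      T = totalCharge (ρ ∷ σ) ρs
      regroup : ∀ B s c m t → B + s * c + (m * B + s * t) ≡ suc m * B + s * (c + t)
      regroup = solve-∀

-- The advice bound

∈-⋃ : ∀ {m} {p : Subset m} {ps x} → p ∈ ps → x ∈ₛ p → x ∈ₛ ⋃ ps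
∈-⋃ (here refl) x∈p = x∈p∪q⁺ (inj₁ x∈p)
∈-⋃ (there p∈ps) x∈p = x∈p∪q⁺ (inj₂ (∈-⋃ p∈ps x∈p))

∈-image : ∀ {n m} (y : Fin n → Fin m) t → y t ∈ₛ ⋃ (L.map (λ i → ⁅ y i ⁆) (allFin n))
∈-image y t = ∈-⋃ (∈-map⁺ (λ i → ⁅ y i ⁆) (∈-allFin t)) (x∈⁅x⁆ (y t))

map-lookup-allFin : ∀ {A : Set} {n} (xs : Vec A n) → L.map (lookup xs) (allFin n) ≡ toList xs
map-lookup-allFin xs = trans (map-tabulate (λ i → i) (lookup xs)) (tabulate-lookup xs)
  where
  tabulate-lookup : ∀ {n} (xs : Vec _ n) → L.tabulate (lookup xs) ≡ toList xs
  tabulate-lookup [] = refl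
  tabulate-lookup (x ∷ xs) = cong (x ∷_) (tabulate-lookup xs)

module Instances (r s : ℕ) (2^s≤r : 2 ^ s ≤ r) where
  open Rounds r s 2^s≤r

  instanceOf : ∀ {n} → Vec Round n → Instance n (r + r)
  instanceOf ρs = record
    { A = available ∘ lookup ρs
    ; x = answer ∘ lookup ρs
    ; A-size = λ i → ∣halfSet∣ (proj₁ (lookup ρs i))
    ; x∈A = answer∈available ∘ lookup ρs
    }

  reverse-before : ∀ σ {m} (ρs : Vec Round m) i →
    L.reverse (before σ ρs i) ≡ L.reverse σ ++ L.take (toℕ i) (toList ρs)
  reverse-before σ (ρ ∷ ρs) zero = sym (++-identityʳ _)
  reverse-before σ (ρ ∷ ρs) (suc i) = begin
    L.reverse (before (ρ ∷ σ) ρs i)                       ≡⟨ reverse-before (ρ ∷ σ) ρs i ⟩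
    L.reverse (ρ ∷ σ) ++ L.take (toℕ i) (toList ρs)       ≡⟨ cong (_++ _) (unfold-reverse ρ σ) ⟩
    (L.reverse σ L.∷ʳ ρ) ++ L.take (toℕ i) (toList ρs)    ≡⟨ ++-assoc (L.reverse σ) (ρ ∷ []) _ ⟩
    L.reverse σ ++ L.take (toℕ (suc i)) (toList (ρ ∷ ρs))  ∎
    where open ≡-Reasoning

  history-instanceOf : ∀ {n} (ρs : Vec Round n) i → history (instanceOf ρs) i ≡ historyOf (before [] ρs i)
  history-instanceOf {n} ρs i = begin
    L.map (revealed ∘ lookup ρs) (L.take (toℕ i) (allFin n))        ≡⟨ map-∘ (L.take (toℕ i) (allFin n)) ⟩
    L.map revealed (L.map (lookup ρs) (L.take (toℕ i) (allFin n)))  ≡⟨ cong (L.map revealed) (take-map (toℕ i) (allFin n)) ⟨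
    L.map revealed (L.take (toℕ i) (L.map (lookup ρs) (allFin n)))  ≡⟨ cong (L.map revealed ∘ L.take (toℕ i)) (map-lookup-allFin ρs) ⟩
    L.map revealed (L.take (toℕ i) (toList ρs))                     ≡⟨ cong (L.map revealed) (reverse-before [] ρs i) ⟨
    L.map revealed (L.reverse (before [] ρs i))                     ∎
    where
    open ≡-Reasoning
    revealed : Round → Subset (r + r) × Fin (r + r)
    revealed ρ = available ρ , answer ρ

  module Play {b : ℕ → ℕ → ℕ} (alg : Alg b) {n} (φ : Vec Bool (b n (r + r)))
              (w u : ℕ) (n≤2^w : n ≤ 2 ^ w) where
    open RoundCode r s w u n 2^s≤r n≤2^w (alg n (r + r) φ)

    output≡labelAt : ∀ ρs i → output {b} alg φ (instanceOf ρs) i ≡ labelAt [] ρs i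
    output≡labelAt ρs i = cong (λ h → alg n (r + r) φ h (available (lookup ρs i))) (history-instanceOf ρs i)

    feasible⇒consistent : ∀ ρs → Feasible (output {b} alg φ (instanceOf ρs)) (instanceOf ρs) → ConsistentRun [] ρs
    feasible⇒consistent ρs feasible i = All.tabulate earlier
      where
      earlier : ∀ {z} → z ∈ priorAnswers (before [] ρs i) (lookup ρs i) → z ∈ₛ available (lookup ρs i)
      earlier z∈ with ∈-seen-before [] ρs i z∈
      ... | inj₂ (t , t<i , same , refl) =
        feasible t i t<i (trans (output≡labelAt ρs t) (trans same (sym (output≡labelAt ρs i))))

    potential≤cost : ∀ ρs → potential (after [] ρs) ≤ 2 ^ u * cost (output {b} alg φ (instanceOf ρs))
    potential≤cost ρs = begin
      potential (after [] ρs)                         ≤⟨ ∑-mono-≤ capped ⟩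
      ∑ (λ g → if lookup U g then 2 ^ u else 0)       ≡⟨ ∑-indicator (2 ^ u) U ⟩
      2 ^ u * cost y                                  ∎
      where
      open ≤-Reasoning
      y : Fin n → Fin n
      y = output {b} alg φ (instanceOf ρs)
      U : Subset n
      U = ⋃ (L.map (λ i → ⁅ y i ⁆) (allFin n))
      capped : ∀ g → length (seen (after [] ρs) g) ⊓ 2 ^ u ≤ (if lookup U g then 2 ^ u else 0)
      capped g with seen (after [] ρs) g in eq
      ... | [] = z≤n
      ... | z ∷ _ with ∈-seen-after [] ρs (subst (z ∈_) (sym eq) (here refl))
      ...   | inj₂ (t , same) rewrite []=⇒lookup (subst (_∈ₛ U) (trans (output≡labelAt ρs t) same) (∈-image y t)) =
        m⊓n≤n _ (2 ^ u)

module _ (r s w u n : ℕ) (2^s≤r : 2 ^ s ≤ r) (n≤2^w : n ≤ 2 ^ w) (w+s≤2^u : w + s ≤ 2 ^ u)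
         {b : ℕ → ℕ → ℕ} (alg : Alg b) (oracle : Instance n (r + r) → Vec Bool (b n (r + r)))
         (feasible : ∀ I → Feasible (output {b} alg (oracle I) I) I)
         (M : ℕ) (cost-bound : ∀ I → s * (2 ^ u * cost (output {b} alg (oracle I) I)) ≤ M) where
  open Rounds r s 2^s≤r
  open Instances r s 2^s≤r

  private
    module Code (φ : Vec Bool (b n (r + r))) = RoundCode r s w u n 2^s≤r n≤2^w (alg n (r + r) φ)
    module Game (φ : Vec Bool (b n (r + r))) = Play alg φ w u n≤2^w

    ℓ : ℕ
    ℓ = n * (2 + r + u) + M

    adviceOf : Vec Round n → Vec Bool (b n (r + r))
    adviceOf ρs = oracle (instanceOf ρs)

    code : Vec Round n → List Bool
    code ρs = Code.encodeRun (adviceOf ρs) [] ρs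

    consistent : ∀ ρs → Code.ConsistentRun (adviceOf ρs) [] ρs
    consistent ρs = Game.feasible⇒consistent (adviceOf ρs) ρs (feasible (instanceOf ρs))

    length-code : ∀ ρs → length (code ρs) ≤ ℓ
    length-code ρs = begin
      length (code ρs)                                   ≤⟨ Code.length-encodeRun φ w+s≤2^u [] ρs (consistent ρs) ⟩
      n * (2 + r + u) + s * Code.totalCharge φ [] ρs      ≤⟨ +-monoʳ-≤ (n * (2 + r + u)) (*-monoʳ-≤ s charges≤cost) ⟩
      n * (2 + r + u) + s * (2 ^ u * cost y)             ≤⟨ +-monoʳ-≤ (n * (2 + r + u)) (cost-bound (instanceOf ρs)) ⟩
      ℓ                                                  ∎
      where
      open ≤-Reasoning
      φ : Vec Bool (b n (r + r))
      φ = adviceOf ρs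
      y : Fin n → Fin n
      y = output {b} alg φ (instanceOf ρs)
      charges≤cost : Code.totalCharge φ [] ρs ≤ 2 ^ u * cost y
      charges≤cost = ≤-trans (m≤m+n _ _) (≤-trans (Code.totalCharge≤potential φ [] ρs) (Game.potential≤cost φ ρs))

    code-injective : ∀ {ρs ρs′} → adviceOf ρs ≡ adviceOf ρs′ → code ρs ≡ code ρs′ → ρs ≡ ρs′
    code-injective {ρs} {ρs′} same-advice = sameAdvice-injective same-advice (consistent ρs) (consistent ρs′)
      where
      sameAdvice-injective : ∀ {φ φ′} → φ ≡ φ′ → Code.ConsistentRun φ [] ρs → Code.ConsistentRun φ′ [] ρs′ →
        Code.encodeRun φ [] ρs ≡ Code.encodeRun φ′ [] ρs′ → ρs ≡ ρs′
      sameAdvice-injective {φ} refl = Code.encodeRun-injective φ []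

    encoding : Vec Bool (n * (r + s)) → Vec Bool (b n (r + r) + suc ℓ)
    encoding xs = adviceOf (rows n r s xs) V.++ pad ℓ (code (rows n r s xs))

    encoding-injective : Injective _≡_ _≡_ encoding
    encoding-injective {xs} {xs′} eq with Vₚ.++-injective (adviceOf (rows n r s xs)) (adviceOf (rows n r s xs′)) eq
    ... | same-advice , same-pad =
      rows-injective n r s (code-injective same-advice (pad-injective ℓ _ _ (length-code (rows n r s xs)) (length-code (rows n r s xs′)) same-pad))

  advice-length-bound : n * (r + s) ≤ b n (r + r) + suc (n * (2 + r + u) + M)
  advice-length-bound = bits-injection⇒≤ encoding encoding-injective

advice≥n*t : ∀ r t w n → 2 ≤ t → 0 < n → 2 ^ (4 * t) ≤ r → n ≤ 2 ^ w → w + 4 * t ≤ 2 ^ t →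
  {b : ℕ → ℕ → ℕ} (alg : Alg b) (oracle : Instance n (r + r) → Vec Bool (b n (r + r))) →
  (∀ I → Feasible (output {b} alg (oracle I) I) I) →
  (∀ I → 4 * t * (2 ^ t * cost (output {b} alg (oracle I) I)) ≤ n) →
  n * t ≤ b n (r + r)
advice≥n*t r t w n 2≤t 0<n 2^4t≤r n≤2^w w+4t≤2^t {b} alg oracle feasible cost-bound =
  +-cancelʳ-≤ X (n * t) (b n (r + r)) (begin
    n * t + X                               ≡⟨ regroup n r t ⟩
    n * (r + 4 * t)                         ≤⟨ advice-length-bound r (4 * t) w t n 2^4t≤r n≤2^w w+4t≤2^t alg oracle feasible n cost-bound ⟩
    b n (r + r) + suc (n * (2 + r + t) + n) ≤⟨ +-monoʳ-≤ (b n (r + r)) overhead ⟩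
    b n (r + r) + X                         ∎)
  where
  open ≤-Reasoning
  X : ℕ
  X = n * r + n * t + 2 * (n * t)
  regroup : ∀ n r t → n * t + (n * r + n * t + 2 * (n * t)) ≡ n * (r + 4 * t)
  regroup = solve-∀
  expand : ∀ n r t → suc (n * (2 + r + t) + n) ≡ n * r + n * t + (1 + 3 * n)
  expand = solve-∀
  4n≡2[2n] : ∀ n → 4 * n ≡ 2 * (n * 2)
  4n≡2[2n] = solve-∀
  overhead : suc (n * (2 + r + t) + n) ≤ X
  overhead = begin
    suc (n * (2 + r + t) + n)      ≡⟨ expand n r t ⟩
    n * r + n * t + (1 + 3 * n)    ≤⟨ +-monoʳ-≤ (n * r + n * t) (+-monoˡ-≤ (3 * n) 0<n) ⟩
    n * r + n * t + 4 * n          ≡⟨ cong (n * r + n * t +_) (4n≡2[2n] n) ⟩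
    n * r + n * t + 2 * (n * 2)    ≤⟨ +-monoʳ-≤ (n * r + n * t) (*-monoʳ-≤ 2 (*-monoʳ-≤ n 2≤t)) ⟩
    X                              ∎

-- Choice of the parameters

polynomial-bound⇒scaled : ∀ {n p q D Y Z} .{{_ : NonZero q}} → 0 < n →
  Z ^ q * n ^ p ≤ D * n ^ q → Y ^ q * D ≤ n ^ p → Y * Z ≤ n
polynomial-bound⇒scaled {n} {p} {q} {D} {Y} {Z} 0<n Z-bound Y-bound =
  ^-cancelʳ-≤ q (*-cancelʳ-≤ _ _ (n ^ p) {{m^n≢0 n p {{>-nonZero 0<n}}}} (begin
    (Y * Z) ^ q * n ^ p      ≡⟨ cong (_* n ^ p) (^-distribʳ-* Y Z q) ⟩
    Y ^ q * Z ^ q * n ^ p    ≡⟨ *-assoc (Y ^ q) (Z ^ q) (n ^ p) ⟩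
    Y ^ q * (Z ^ q * n ^ p)  ≤⟨ *-monoʳ-≤ (Y ^ q) Z-bound ⟩
    Y ^ q * (D * n ^ q)      ≡⟨ *-assoc (Y ^ q) D (n ^ q) ⟨
    Y ^ q * D * n ^ q        ≤⟨ *-monoˡ-≤ (n ^ q) Y-bound ⟩
    n ^ p * n ^ q            ≡⟨ *-comm (n ^ p) (n ^ q) ⟩
    n ^ q * n ^ p            ∎))
  where open ≤-Reasoning

4[1+t]≡4t+4 : ∀ t → 4 * suc t ≡ 4 * t + 4
4[1+t]≡4t+4 t = trans (*-suc 4 t) (+-comm 4 (4 * t))

quarter-log₂ : ∀ r .{{_ : NonZero r}} → ∃[ t ] 2 ^ (4 * t) ≤ r × r < 2 ^ (4 * t + 4)
quarter-log₂ 1 = 0 , ≤-refl , s≤s (s≤s z≤n)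
quarter-log₂ (suc (suc r)) with quarter-log₂ (suc r)
... | t , lower , upper with suc (suc r) <? 2 ^ (4 * t + 4)
...   | yes below = t , m≤n⇒m≤1+n lower , below
...   | no ≮ = suc t , ≤-reflexive (sym reached) ,
                 subst (_< 2 ^ (4 * suc t + 4)) (sym reached) (^-monoʳ-< 2 (s≤s (s≤s z≤n)) (m<m+n (4 * suc t) {4} z<s))
  where
  reached : suc (suc r) ≡ 2 ^ (4 * suc t)
  reached = trans (≤-antisym upper (≮⇒≥ ≮)) (cong (2 ^_) (sym (4[1+t]≡4t+4 t)))

halve-pow : ∀ x {r} → 2 ^ (x + 1) ≤ r + r → 2 ^ x ≤ r
halve-pow x {r} 2^[x+1]≤r+r = *-cancelˡ-≤ 2 (begin
  2 * 2 ^ x      ≡⟨ cong (2 ^_) (+-comm 1 x) ⟩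
  2 ^ (x + 1)    ≤⟨ 2^[x+1]≤r+r ⟩
  r + r          ≡⟨ cong (r +_) (+-identityʳ r) ⟨
  2 * r          ∎)
  where open ≤-Reasoning

quarter-log₂-≥ : ∀ a {r} → 2 ^ (4 * a + 1) ≤ r + r →
  ∃[ t ] 2 ^ (4 * t) ≤ r × r < 2 ^ (4 * t + 4) × a ≤ t
quarter-log₂-≥ a {r} large with quarter-log₂ r {{>-nonZero (≤-trans (m^n>0 2 (4 * a)) (halve-pow (4 * a) large))}}
... | t , lower , upper with a ≤? t
...   | yes a≤t = t , lower , upper , a≤t
...   | no a≰t = contradiction (begin
        2 ^ (4 * t + 4)    ≡⟨ cong (2 ^_) (4[1+t]≡4t+4 t) ⟨
        2 ^ (4 * suc t)    ≤⟨ ^-monoʳ-≤ 2 (*-monoʳ-≤ 4 (≰⇒> a≰t)) ⟩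
        2 ^ (4 * a)        ≤⟨ halve-pow (4 * a) large ⟩
        r                  ∎) (<⇒≱ upper)
  where open ≤-Reasoning

square≤pow : ∀ m → (m + 7) * (m + 7) ≤ 2 ^ (m + 6)
square≤pow zero = m≤m+n 49 15
square≤pow (suc m) = begin
  (suc m + 7) * (suc m + 7)                    ≡⟨ square-suc m ⟩
  (m + 7) * (m + 7) + (2 * (m + 7) + 1)        ≤⟨ +-monoʳ-≤ ((m + 7) * (m + 7)) linear≤square ⟩
  (m + 7) * (m + 7) + (m + 7) * (m + 7)        ≤⟨ +-mono-≤ (square≤pow m) (square≤pow m) ⟩
  2 ^ (m + 6) + 2 ^ (m + 6)                    ≡⟨ cong (2 ^ (m + 6) +_) (+-identityʳ _) ⟨
  2 ^ (suc m + 6)                              ∎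
  where
  open ≤-Reasoning
  square-suc : ∀ m → (suc m + 7) * (suc m + 7) ≡ (m + 7) * (m + 7) + (2 * (m + 7) + 1)
  square-suc = solve-∀
  triple : ∀ m → 2 * (m + 7) + (m + 7) ≡ 3 * (m + 7)
  triple = solve-∀
  linear≤square : 2 * (m + 7) + 1 ≤ (m + 7) * (m + 7)
  7≤m+7 : 7 ≤ m + 7
  7≤m+7 = m≤n+m 7 m
  linear≤square = begin
    2 * (m + 7) + 1        ≤⟨ +-monoʳ-≤ (2 * (m + 7)) (≤-trans (s≤s z≤n) 7≤m+7) ⟩
    2 * (m + 7) + (m + 7)  ≡⟨ triple m ⟩
    3 * (m + 7)            ≤⟨ *-monoˡ-≤ (m + 7) (≤-trans (s≤s (s≤s (s≤s z≤n))) 7≤m+7) ⟩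
    (m + 7) * (m + 7)      ∎

linear≤pow : ∀ a t → a + 6 ≤ t → a * (t + 1) ≤ 2 ^ t
linear≤pow a t a+6≤t with m≤n⇒∃[o]m+o≡n a+6≤t
... | m , refl = begin
  a * (a + 6 + m + 1)              ≤⟨ *-monoˡ-≤ (a + 6 + m + 1) (m≤m+n a (m + 7)) ⟩
  (a + (m + 7)) * (a + 6 + m + 1)  ≡⟨ regroup a m ⟩
  (a + m + 7) * (a + m + 7)        ≤⟨ square≤pow (a + m) ⟩
  2 ^ (a + m + 6)                  ≡⟨ cong (2 ^_) (shuffle a m) ⟩
  2 ^ (a + 6 + m)                  ∎
  where
  open ≤-Reasoning
  regroup : ∀ a m → (a + (m + 7)) * (a + 6 + m + 1) ≡ (a + m + 7) * (a + m + 7)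
  regroup = solve-∀
  shuffle : ∀ a m → a + m + 6 ≡ a + 6 + m
  shuffle = solve-∀

module Scale {c r t : ℕ} (lower : 2 ^ (4 * t) ≤ r) (upper : r < 2 ^ (4 * t + 4)) (t-large : 5 * c + 11 ≤ t) where

  open ≤-Reasoning

  w : ℕ
  w = (4 * t + 5) * c

  0<r+r : 0 < r + r
  0<r+r = ≤-trans (m^n>0 2 (4 * t)) (≤-trans lower (m≤m+n r r))

  10≤t : 10 ≤ t
  10≤t = ≤-trans (n≤1+n 10) (≤-trans (m≤n+m 11 (5 * c)) t-large)

  size≤2^w : (r + r) ^ c ≤ 2 ^ w
  size≤2^w = begin
    (r + r) ^ c                            ≤⟨ ^-monoˡ-≤ c (+-mono-≤ (<⇒≤ upper) (<⇒≤ upper)) ⟩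
    (2 ^ (4 * t + 4) + 2 ^ (4 * t + 4)) ^ c ≡⟨ cong (λ x → (2 ^ (4 * t + 4) + x) ^ c) (+-identityʳ _) ⟨
    (2 ^ suc (4 * t + 4)) ^ c               ≡⟨ cong (λ x → (2 ^ x) ^ c) (+-suc (4 * t) 4) ⟨
    (2 ^ (4 * t + 5)) ^ c                   ≡⟨ ^-*-assoc 2 (4 * t + 5) c ⟩
    2 ^ w                                   ∎

  w+4t≤2^t : w + 4 * t ≤ 2 ^ t
  w+4t≤2^t = begin
    w + 4 * t                               ≤⟨ m≤m+n (w + 4 * t) (c * t + t + 5) ⟩
    w + 4 * t + (c * t + t + 5)             ≡⟨ regroup c t ⟩
    (5 * c + 5) * (t + 1)                   ≤⟨ linear≤pow (5 * c + 5) t (≤-trans (≤-reflexive (+-assoc (5 * c) 5 6)) t-large) ⟩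
    2 ^ t                                   ∎
    where
    regroup : ∀ c t → (4 * t + 5) * c + 4 * t + (c * t + t + 5) ≡ (5 * c + 5) * (t + 1)
    regroup = solve-∀

  scale≤r+r : 4 * t * 2 ^ t ≤ r + r
  scale≤r+r = begin
    4 * t * 2 ^ t      ≤⟨ *-monoˡ-≤ (2 ^ t) (≤-trans (*-monoʳ-≤ 4 (m≤m+n t 1)) (linear≤pow 4 t 10≤t)) ⟩
    2 ^ t * 2 ^ t      ≡⟨ ^-distribˡ-+-* 2 t t ⟨
    2 ^ (t + t)        ≤⟨ ^-monoʳ-≤ 2 (+-monoʳ-≤ t (m≤n*m t 3)) ⟩
    2 ^ (t + 3 * t)    ≤⟨ lower ⟩
    r                  ≤⟨ m≤m+n r r ⟩
    r + r              ∎

  log≤9*t*c : ⌊log₂ ((r + r) ^ c) ⌋ ≤ 9 * t * c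
  log≤9*t*c = begin
    ⌊log₂ ((r + r) ^ c) ⌋  ≤⟨ ⌊log₂⌋-mono-≤ size≤2^w ⟩
    ⌊log₂ (2 ^ w) ⌋        ≡⟨ ⌊log₂[2^n]⌋≡n w ⟩
    (4 * t + 5) * c        ≤⟨ *-monoˡ-≤ c (+-monoʳ-≤ (4 * t) (*-monoʳ-≤ 5 (≤-trans (s≤s z≤n) 10≤t))) ⟩
    (4 * t + 5 * t) * c    ≡⟨ cong (_* c) (*-distribʳ-+ t 4 5) ⟨
    9 * t * c              ∎

m≤m^n : ∀ m n .{{_ : NonZero m}} .{{_ : NonZero n}} → m ≤ m ^ n
m≤m^n m (suc n) = m≤m*n m (m ^ n) {{m^n≢0 m n}}

-- Large enough to force t ≥ 5c + 11 (through quarter-log₂-≥) and D ≤ k.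
threshold : ℕ → ℕ → ℕ
threshold c D = 2 ^ (4 * (5 * c + 11) + 1) + D

advice-lower-bound : ∀ {c p q D r} .{{_ : NonZero q}} → q < p * c → threshold c D ≤ r + r →
  {b : ℕ → ℕ → ℕ} (alg : Alg b) (oracle : Instance ((r + r) ^ c) (r + r) → Vec Bool (b ((r + r) ^ c) (r + r))) →
  (∀ I → Feasible (output {b} alg (oracle I) I) I) →
  (∀ I → cost (output {b} alg (oracle I) I) ^ q * ((r + r) ^ c) ^ p ≤ D * ((r + r) ^ c) ^ q) →
  (r + r) ^ c * ⌊log₂ ((r + r) ^ c) ⌋ ≤ 9 * c * b ((r + r) ^ c) (r + r)
advice-lower-bound {c} {p} {q} {D} {r} q<p*c large {b} alg oracle feasible cost-bound
  with quarter-log₂-≥ (5 * c + 11) (≤-trans (m≤m+n _ D) large)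
... | t , lower , upper , t-large = begin
  n * ⌊log₂ n ⌋          ≤⟨ *-monoʳ-≤ n log≤9*t*c ⟩
  n * (9 * t * c)        ≡⟨ regroup n t c ⟩
  9 * c * (n * t)        ≤⟨ *-monoʳ-≤ (9 * c) n*t≤advice ⟩
  9 * c * b n (r + r)    ∎
  where
  open Scale {c} lower upper t-large
  open ≤-Reasoning
  n : ℕ
  n = (r + r) ^ c
  regroup : ∀ n t c → n * (9 * t * c) ≡ 9 * c * (n * t)
  regroup = solve-∀
  instance
    r+r≢0 : NonZero (r + r)
    r+r≢0 = >-nonZero 0<r+r
  -- The only use of δ > 1/c, in the form q + 1 ≤ p c.
  scale^q*D≤n^p : (4 * t * 2 ^ t) ^ q * D ≤ n ^ p
  scale^q*D≤n^p = begin
    (4 * t * 2 ^ t) ^ q * D  ≤⟨ *-mono-≤ (^-monoˡ-≤ q scale≤r+r) (≤-trans (m≤n+m D _) large) ⟩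
    (r + r) ^ q * (r + r)    ≡⟨ *-comm ((r + r) ^ q) (r + r) ⟩
    (r + r) ^ suc q          ≤⟨ ^-monoʳ-≤ (r + r) q<p*c ⟩
    (r + r) ^ (p * c)        ≡⟨ trans (cong ((r + r) ^_) (*-comm p c)) (sym (^-*-assoc (r + r) c p)) ⟩
    n ^ p                    ∎
  n*t≤advice : n * t ≤ b n (r + r)
  n*t≤advice = advice≥n*t r t w n (≤-trans (s≤s (s≤s z≤n)) 10≤t) (m^n>0 (r + r) c) lower size≤2^w w+4t≤2^t alg oracle feasible
    λ I → ≤-trans (≤-reflexive (sym (*-assoc (4 * t) (2 ^ t) _)))
                  (polynomial-bound⇒scaled {p = p} (m^n>0 (r + r) c) (cost-bound I) scale^q*D≤n^p)

theorem12 : (c p q : ℕ) → 0 < q → q < p * c →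
    (b : ℕ → ℕ → ℕ) (alg : Alg b) →
    (Σ[ oracle ∈ ((k : ℕ) → Instance (k ^ c) k → Vec Bool (b (k ^ c) k)) ] ∃[ D ] ∃[ N₀ ]
       (∀ (k : ℕ) → 2 ∣ k → k ≤ k ^ c → (I : Instance (k ^ c) k) →
          Feasible (output {b} alg (oracle k I) I) I
          × (N₀ ≤ k ^ c →
             cost (output {b} alg (oracle k I) I) ^ q * (k ^ c) ^ p ≤ D * (k ^ c) ^ q))) →
    ∃[ E ] ∃[ N₁ ] (∀ (k : ℕ) → 2 ∣ k → N₁ ≤ k ^ c →
       k ^ c * ⌊log₂ (k ^ c) ⌋ ≤ E * b (k ^ c) k)
theorem12 c p q 0<q q<p*c b alg (oracle , D , N₀ , H) = 9 * c , N₀ + threshold c D ^ c , bound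
  where
  instance
    q≢0 : NonZero q
    q≢0 = >-nonZero 0<q
    c≢0 : NonZero c
    c≢0 = m*n≢0⇒n≢0 p {{>-nonZero (≤-trans (s≤s z≤n) q<p*c)}}
  bound-even : ∀ r → N₀ + threshold c D ^ c ≤ (r + r) ^ c →
    (r + r) ^ c * ⌊log₂ ((r + r) ^ c) ⌋ ≤ 9 * c * b ((r + r) ^ c) (r + r)
  bound-even r N₁≤n = advice-lower-bound {c} {p} {q} {D} {r} q<p*c large alg (oracle (r + r))
    (λ I → proj₁ (H (r + r) even k≤k^c I)) (λ I → proj₂ (H (r + r) even k≤k^c I) N₀≤n)
    where
    large : threshold c D ≤ r + r
    large = ^-cancelʳ-≤ c (≤-trans (m≤n+m _ N₀) N₁≤n)
    N₀≤n : N₀ ≤ (r + r) ^ c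
    N₀≤n = ≤-trans (m≤m+n N₀ _) N₁≤n
    even : 2 ∣ r + r
    even = divides r (r+r≡r*2 r)
    k≤k^c : r + r ≤ (r + r) ^ c
    k≤k^c = m≤m^n (r + r) c {{>-nonZero (≤-trans (≤-trans (m^n>0 2 (4 * (5 * c + 11) + 1)) (m≤m+n _ D)) large)}}
  bound : ∀ k → 2 ∣ k → N₀ + threshold c D ^ c ≤ k ^ c → k ^ c * ⌊log₂ (k ^ c) ⌋ ≤ 9 * c * b (k ^ c) k
  bound .(r * 2) (divides r refl) =
    subst (λ k → N₀ + threshold c D ^ c ≤ k ^ c → k ^ c * ⌊log₂ (k ^ c) ⌋ ≤ 9 * c * b (k ^ c) k)
          (r+r≡r*2 r) (bound-even r)
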